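{- Let $\chi_1,\chi_2$ be arbitrary Dirichlet characters modulo $q_1,q_2$, and let $a$ and $c\ge1$ be coprime integers with $q_1q_2\mid c$. Then $S_{\chi_1,\chi_2}(a,c)=S_{\chi_1,\chi_2}(\alpha a,\alpha c)$ for all positive integers $\alpha$.
   Context: Dirichlet characters are extended by $0$ to integers not coprime to their modulus. $B_1(x)=0$ if $x\in\mathbb{Z}$ and $B_1(x)=x-\lfloor x\rfloor-\tfrac12$ otherwise. For any integer $a$ and $c\ge1$ with $q_1q_2\mid c$, \[S_{\chi_1,\chi_2}(a,c)=\sum_{j\bmod c}\sum_{n\bmod q_1}\overline{\chi_2}(j)\overline{\chi_1}(n)B_1\!\Big(\frac{j}{c}\Big)B_1\!\Big(\frac{n}{q_1}+\frac{aj}{c}\Big).\] -}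

module Defs where

open import Level using (Level; _⊔_)
open import Data.Nat as ℕ using (ℕ; zero; suc; NonZero)
open import Data.Nat.GCD using (gcd)
open import Data.Integer as ℤ using (ℤ; +_)
open import Data.Rational as ℚ using (ℚ; floor; ½; ↧ₙ_)
import Data.Rational.Properties as ℚP
open import Algebra.Bundles using (CommutativeRing)
open import Algebra.Morphism.Structures using (module RingMorphisms)
open import Relation.Nullary using (¬_)
open import Relation.Nullary.Decidable using (does)
open import Relation.Binary.PropositionalEquality using (_≡_)
open import Data.Bool using (if_then_else_)

B₁ : ℚ → ℚ
B₁ x = if does ((↧ₙ x) ℕ.≟ 1) then ℚ.0ℚ else (x ℚ.- (floor x ℚ./ 1)) ℚ.- ½

-- Coefficient ring standing in for ℂ: a commutative ring R together with
-- a ring homomorphism ι : ℚ → R and an involutive ring automorphism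
-- `conj` (complex conjugation) fixing ι(ℚ).  (ℂ with complex conjugation
-- is an instance.)
record ConjRing (c ℓ : Level) : Set (Level.suc (c ⊔ ℓ)) where
  field
    R : CommutativeRing c ℓ
  open CommutativeRing R public
  field
    ι : ℚ → Carrier
    ι-hom : RingMorphisms.IsRingHomomorphism
              (CommutativeRing.rawRing ℚP.+-*-commutativeRing) rawRing ι
    conj : Carrier → Carrier
    conj-hom : RingMorphisms.IsRingHomomorphism rawRing rawRing conj
    conj-invol : ∀ x → conj (conj x) ≈ x
    conj-ι : ∀ r → conj (ι r) ≈ ι r

module _ {c ℓ : Level} (K : ConjRing c ℓ) where
  open ConjRing K

  record DirichletChar (q : ℕ) : Set (c ⊔ ℓ) where
    field
      χ : ℤ → Carrier
      χ-mult : ∀ m n → χ (m ℤ.* n) ≈ χ m * χ n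
      χ-periodic : ∀ n → χ (n ℤ.+ + q) ≈ χ n
      χ-one : χ (+ 1) ≈ 1#
      χ-zero : ∀ n → ¬ (gcd ℤ.∣ n ∣ q ≡ 1) → χ n ≈ 0#
      χ-nonzero : ∀ n → gcd ℤ.∣ n ∣ q ≡ 1 → ¬ (χ n ≈ 0#)

  Σ< : ℕ → (ℕ → Carrier) → Carrier
  Σ< zero f = 0#
  Σ< (suc n) f = Σ< n f + f n

  -- S_{χ₁,χ₂}(a,c) = Σ_{j mod c} Σ_{n mod q₁} χ̄₂(j) χ̄₁(n) B₁(j/c) B₁(n/q₁ + a j / c),
  -- with j ranging over 0..c-1 and n over 0..q₁-1.
  S : {q₁ q₂ : ℕ} .{{_ : NonZero q₁}} →
      DirichletChar q₁ → DirichletChar q₂ → ℤ → (c' : ℕ) .{{_ : NonZero c'}} → Carrier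
  S {q₁} χ₁ χ₂ a c' =
    Σ< c' λ j → Σ< q₁ λ n →
      conj (DirichletChar.χ χ₂ (+ j)) * conj (DirichletChar.χ χ₁ (+ n))
      * ι (B₁ ((+ j) ℚ./ c'))
      * ι (B₁ (((+ n) ℚ./ q₁) ℚ.+ ((a ℤ.* + j) ℚ./ c')))

-- Split each residue i mod αc as i = kc + j with k < α and j < c. Since q₂ ∣ c, χ₂(i) = χ₂(j),
-- and since B₁ has period 1 and αa·i/(αc) = aj/c + ak, the second B₁ factor only depends on j.
-- The sum over k therefore only meets B₁((kc + j)/(αc)) = B₁((j/c + k)/α), and the distribution
-- relation Σ_{k<α} B₁((x + k)/α) = B₁(x) turns it back into the summand of S(a, c). For x = j/c
-- with 0 ≤ j < c that relation is the sum of the arithmetic progression (kc + j)/(αc) − ½,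
-- corrected by ½ at k = 0 when j = 0.
module Submission where

open import Defs
open import Level using (Level; 0ℓ)
open import Function using (id; _∘_)
open import Data.Empty using (⊥-elim)
open import Data.Product using (_×_; _,_; proj₁)
open import Data.Sum using (inj₂)
open import Data.Nat as ℕ using (ℕ; zero; suc; NonZero)
open import Data.Nat.Properties using (m*n≢0)
import Data.Nat.Properties as ℕP
open import Data.Nat.DivMod using (m<n⇒m%n≡m)
open import Data.Nat.GCD using (gcd; gcd[m,n]≢0)
open import Data.Nat.Divisibility using (_∣_; divides; ∣-refl; ∣-trans; n∣m*n)
open import Data.Nat.Coprimality using (Coprime)
import Data.Nat.Coprimality as Coprimality
open import Data.Integer as ℤ using (ℤ; +_; _%ℕ_; _/ℕ_)
import Data.Integer.Properties as ℤP
open import Data.Integer.DivMod using (a≡a%ℕn+[a/ℕn]*n; n%ℕd<d; div-pos-is-/ℕ)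
open import Data.Integer.Tactic.RingSolver using (solve-∀)
open import Data.Rational as ℚ using (ℚ; mkℚ; _/_; ½; ↥_; ↧_; ↧ₙ_; floor; toℚᵘ)
import Data.Rational.Properties as ℚP
open import Data.Rational.Unnormalised as ℚᵘ using (mkℚᵘ; *≡*) renaming (_/_ to _/ᵘ_)
import Data.Rational.Unnormalised.Properties as ℚᵘP
open import Algebra.Bundles using (CommutativeMonoid)
open import Algebra.Morphism.Structures using (module RingMorphisms)
import Algebra.Morphism.Construct.Identity as Identity
import Algebra.Properties.CommutativeSemigroup as CommutativeSemigroupProperties
open import Algebra.Properties.AbelianGroup ℤP.+-0-abelianGroup using () renaming (∙-cancelʳ to +-cancelʳ)
open CommutativeSemigroupProperties (CommutativeMonoid.commutativeSemigroup ℚP.+-0-commutativeMonoid)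
  using (xy∙z≈xz∙y)
open import Relation.Binary.Definitions using (tri<; tri≈; tri>)
open import Relation.Binary.PropositionalEquality
  using (_≡_; _≢_; refl; sym; trans; cong; cong₂; module ≡-Reasoning)
open import Relation.Nullary using (yes; no)

toℚᵘ-/ : ∀ p d .{{_ : NonZero d}} → toℚᵘ (p / d) ℚᵘ.≃ p /ᵘ d
toℚᵘ-/ p (suc d) = ℚP.toℚᵘ-fromℚᵘ (mkℚᵘ p d)

*≡*⇒/≡ : ∀ p d r e .{{_ : NonZero d}} .{{_ : NonZero e}} → p ℤ.* + e ≡ r ℤ.* + d → p / d ≡ r / e
*≡*⇒/≡ p (suc d) r (suc e) eq = ℚP.fromℚᵘ-cong {mkℚᵘ p d} {mkℚᵘ r e} (*≡* eq)

p/d+r/e≡[pe+rd]/[de] : ∀ p d r e .{{_ : NonZero d}} .{{_ : NonZero e}} →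
  p / d ℚ.+ r / e ≡ ((p ℤ.* + e ℤ.+ r ℤ.* + d) / (d ℕ.* e)) {{m*n≢0 d e}}
p/d+r/e≡[pe+rd]/[de] p d@(suc _) r e@(suc _) = ℚP.toℚᵘ-injective (begin
  toℚᵘ (p / d ℚ.+ r / e)                        ≈⟨ ℚP.toℚᵘ-homo-+ (p / d) (r / e) ⟩
  toℚᵘ (p / d) ℚᵘ.+ toℚᵘ (r / e)                ≈⟨ ℚᵘP.+-cong (toℚᵘ-/ p d) (toℚᵘ-/ r e) ⟩
  p /ᵘ d ℚᵘ.+ r /ᵘ e                            ≈⟨ toℚᵘ-/ (p ℤ.* + e ℤ.+ r ℤ.* + d) (d ℕ.* e) ⟨
  toℚᵘ ((p ℤ.* + e ℤ.+ r ℤ.* + d) / (d ℕ.* e))  ∎)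
  where open ℚᵘP.≃-Reasoning

p/d+r/d≡[p+r]/d : ∀ p r d .{{_ : NonZero d}} → p / d ℚ.+ r / d ≡ (p ℤ.+ r) / d
p/d+r/d≡[p+r]/d p r d = trans (p/d+r/e≡[pe+rd]/[de] p d r d)
  (*≡*⇒/≡ (p ℤ.* + d ℤ.+ r ℤ.* + d) (d ℕ.* d) (p ℤ.+ r) d {{m*n≢0 d d}}
    (trans (distribute p r (+ d)) (cong ((p ℤ.+ r) ℤ.*_) (sym (ℤP.pos-* d d)))))
  where
  distribute : ∀ p r d → (p ℤ.* d ℤ.+ r ℤ.* d) ℤ.* d ≡ (p ℤ.+ r) ℤ.* (d ℤ.* d)
  distribute = solve-∀

p/d+z≡[p+zd]/d : ∀ p d z .{{_ : NonZero d}} → p / d ℚ.+ z / 1 ≡ (p ℤ.+ z ℤ.* + d) / d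
p/d+z≡[p+zd]/d p d z = trans (p/d+r/e≡[pe+rd]/[de] p d z 1)
  (ℚP./-cong (cong (λ n → n ℤ.+ z ℤ.* + d) (ℤP.*-identityʳ p)) (ℕP.*-identityʳ d))
  where
  instance
    d*1≢0 : NonZero (d ℕ.* 1)
    d*1≢0 = m*n≢0 d 1

-[p/d]≡[-p]/d : ∀ p d .{{_ : NonZero d}} → ℚ.- (p / d) ≡ (ℤ.- p) / d
-[p/d]≡[-p]/d p d@(suc _) = ℚP.toℚᵘ-injective (begin
  toℚᵘ (ℚ.- (p / d))   ≈⟨ ℚP.toℚᵘ-homo‿- (p / d) ⟩
  ℚᵘ.- toℚᵘ (p / d)    ≈⟨ ℚᵘP.-‿cong (toℚᵘ-/ p d) ⟩
  ℚᵘ.- (p /ᵘ d)        ≈⟨ toℚᵘ-/ (ℤ.- p) d ⟨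
  toℚᵘ ((ℤ.- p) / d)   ∎)
  where open ℚᵘP.≃-Reasoning

p/d-½≡[2p-d]/[2d] : ∀ p d .{{_ : NonZero d}} → p / d ℚ.- ½ ≡ ((p ℤ.* + 2 ℤ.- + d) / (d ℕ.* 2)) {{m*n≢0 d 2}}
p/d-½≡[2p-d]/[2d] p d = begin
  p / d ℚ.- ½                                    ≡⟨ cong (p / d ℚ.+_) (-[p/d]≡[-p]/d (+ 1) 2) ⟩
  p / d ℚ.+ ℤ.-1ℤ / 2                            ≡⟨ p/d+r/e≡[pe+rd]/[de] p d ℤ.-1ℤ 2 ⟩
  (p ℤ.* + 2 ℤ.+ ℤ.-1ℤ ℤ.* + d) / (d ℕ.* 2)      ≡⟨ ℚP./-cong (cong (λ n → p ℤ.* + 2 ℤ.+ n) (ℤP.-1*i≡-i (+ d))) refl ⟩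
  (p ℤ.* + 2 ℤ.- + d) / (d ℕ.* 2)                ∎
  where
  open ≡-Reasoning
  instance
    d*2≢0 : NonZero (d ℕ.* 2)
    d*2≢0 = m*n≢0 d 2

r+qd<r'+q'd : ∀ {d r r'} q q' → r ℕ.< d → q ℤ.< q' → + r ℤ.+ q ℤ.* + d ℤ.< + r' ℤ.+ q' ℤ.* + d
r+qd<r'+q'd {d} {r} {r'} q q' r<d q<q' = begin-strict
  + r ℤ.+ q ℤ.* + d             <⟨ ℤP.+-monoˡ-< (q ℤ.* + d) (ℤ.+<+ r<d) ⟩
  + d ℤ.+ q ℤ.* + d             ≡⟨ suc-* q (+ d) ⟨
  (ℤ.1ℤ ℤ.+ q) ℤ.* + d          ≤⟨ ℤP.*-monoʳ-≤-nonNeg (+ d) (ℤP.i<j⇒suc[i]≤j q<q') ⟩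
  q' ℤ.* + d                    ≤⟨ ℤP.i≤j+i (q' ℤ.* + d) (+ r') ⟩
  + r' ℤ.+ q' ℤ.* + d           ∎
  where
  open ℤP.≤-Reasoning
  suc-* : ∀ q d → (ℤ.1ℤ ℤ.+ q) ℤ.* d ≡ d ℤ.+ q ℤ.* d
  suc-* = solve-∀

quotient-unique : ∀ {d r r'} q q' → r ℕ.< d → r' ℕ.< d →
  + r ℤ.+ q ℤ.* + d ≡ + r' ℤ.+ q' ℤ.* + d → q ≡ q'
quotient-unique q q' r<d r'<d eq with ℤP.<-cmp q q'
... | tri< q<q' _ _ = ⊥-elim (ℤP.<⇒≢ (r+qd<r'+q'd q q' r<d q<q') eq)
... | tri≈ _ q≡q' _ = q≡q'
... | tri> _ _ q>q' = ⊥-elim (ℤP.<⇒≢ (r+qd<r'+q'd q' q r'<d q>q') (sym eq))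

divℕ-unique : ∀ p d .{{_ : NonZero d}} r q → r ℕ.< d → p ≡ + r ℤ.+ q ℤ.* + d →
  p %ℕ d ≡ r × p /ℕ d ≡ q
divℕ-unique p d r q r<d p≡r+qd = remainder , quotient
  where
  euclid : + (p %ℕ d) ℤ.+ (p /ℕ d) ℤ.* + d ≡ + r ℤ.+ q ℤ.* + d
  euclid = trans (sym (a≡a%ℕn+[a/ℕn]*n p d)) p≡r+qd
  quotient : p /ℕ d ≡ q
  quotient = quotient-unique (p /ℕ d) q (n%ℕd<d p d) r<d euclid
  remainder : p %ℕ d ≡ r
  remainder = ℤP.+-injective (+-cancelʳ (q ℤ.* + d) (+ (p %ℕ d)) (+ r)
    (trans (cong (λ q → + (p %ℕ d) ℤ.+ q ℤ.* + d) (sym quotient)) euclid))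

[p+zd]%ℕd≡p%ℕd : ∀ p z d .{{_ : NonZero d}} → (p ℤ.+ z ℤ.* + d) %ℕ d ≡ p %ℕ d
[p+zd]%ℕd≡p%ℕd p z d = proj₁ (divℕ-unique (p ℤ.+ z ℤ.* + d) d (p %ℕ d) (p /ℕ d ℤ.+ z) (n%ℕd<d p d) (begin
  p ℤ.+ z ℤ.* + d                                   ≡⟨ cong (λ n → n ℤ.+ z ℤ.* + d) (a≡a%ℕn+[a/ℕn]*n p d) ⟩
  + (p %ℕ d) ℤ.+ (p /ℕ d) ℤ.* + d ℤ.+ z ℤ.* + d     ≡⟨ regroup (+ (p %ℕ d)) (p /ℕ d) z (+ d) ⟩
  + (p %ℕ d) ℤ.+ (p /ℕ d ℤ.+ z) ℤ.* + d             ∎))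
  where
  open ≡-Reasoning
  regroup : ∀ r q z d → r ℤ.+ q ℤ.* d ℤ.+ z ℤ.* d ≡ r ℤ.+ (q ℤ.+ z) ℤ.* d
  regroup = solve-∀

[ug]%ℕ[vg]≡[u%ℕv]*g : ∀ u v g .{{_ : NonZero v}} .{{_ : NonZero g}} →
  ((u ℤ.* + g) %ℕ (v ℕ.* g)) {{m*n≢0 v g}} ≡ (u %ℕ v) ℕ.* g
[ug]%ℕ[vg]≡[u%ℕv]*g u v g = proj₁ (divℕ-unique (u ℤ.* + g) (v ℕ.* g) {{m*n≢0 v g}}
  ((u %ℕ v) ℕ.* g) (u /ℕ v) (ℕP.*-monoˡ-< g (n%ℕd<d u v)) (begin
    u ℤ.* + g                                          ≡⟨ cong (ℤ._* + g) (a≡a%ℕn+[a/ℕn]*n u v) ⟩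
    (+ (u %ℕ v) ℤ.+ (u /ℕ v) ℤ.* + v) ℤ.* + g          ≡⟨ distribute (+ (u %ℕ v)) (u /ℕ v) (+ v) (+ g) ⟩
    + (u %ℕ v) ℤ.* + g ℤ.+ (u /ℕ v) ℤ.* (+ v ℤ.* + g)  ≡⟨ cong₂ (λ r d → r ℤ.+ (u /ℕ v) ℤ.* d)
                                                             (ℤP.pos-* (u %ℕ v) g) (ℤP.pos-* v g) ⟨
    + ((u %ℕ v) ℕ.* g) ℤ.+ (u /ℕ v) ℤ.* + (v ℕ.* g)    ∎))
  where
  open ≡-Reasoning
  distribute : ∀ r q v g → (r ℤ.+ q ℤ.* v) ℤ.* g ≡ r ℤ.* g ℤ.+ q ℤ.* (v ℤ.* g)
  distribute = solve-∀

%ℕ≡0⇒∣ : ∀ u v .{{_ : NonZero v}} → u %ℕ v ≡ 0 → v ∣ ℤ.∣ u ∣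
%ℕ≡0⇒∣ u v r≡0 = divides ℤ.∣ u /ℕ v ∣ (begin
  ℤ.∣ u ∣                                  ≡⟨ cong ℤ.∣_∣ (a≡a%ℕn+[a/ℕn]*n u v) ⟩
  ℤ.∣ + (u %ℕ v) ℤ.+ (u /ℕ v) ℤ.* + v ∣    ≡⟨ cong (λ r → ℤ.∣ + r ℤ.+ (u /ℕ v) ℤ.* + v ∣) r≡0 ⟩
  ℤ.∣ + 0 ℤ.+ (u /ℕ v) ℤ.* + v ∣           ≡⟨ cong ℤ.∣_∣ (ℤP.+-identityˡ ((u /ℕ v) ℤ.* + v)) ⟩
  ℤ.∣ (u /ℕ v) ℤ.* + v ∣                   ≡⟨ ℤP.abs-* (u /ℕ v) (+ v) ⟩
  ℤ.∣ u /ℕ v ∣ ℕ.* v                       ∎)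
  where open ≡-Reasoning

p/d-[p/ℕd]≡[p%ℕd]/d : ∀ p d .{{_ : NonZero d}} → p / d ℚ.- (p /ℕ d) / 1 ≡ (+ (p %ℕ d)) / d
p/d-[p/ℕd]≡[p%ℕd]/d p d = begin
  p / d ℚ.- (p /ℕ d) / 1                   ≡⟨ cong (p / d ℚ.+_) (-[p/d]≡[-p]/d (p /ℕ d) 1) ⟩
  p / d ℚ.+ (ℤ.- (p /ℕ d)) / 1             ≡⟨ p/d+z≡[p+zd]/d p d (ℤ.- (p /ℕ d)) ⟩
  (p ℤ.+ ℤ.- (p /ℕ d) ℤ.* + d) / d         ≡⟨ ℚP./-cong remainder refl ⟩
  (+ (p %ℕ d)) / d                         ∎
  where
  open ≡-Reasoning
  cancel : ∀ r q d → r ℤ.+ q ℤ.* d ℤ.+ ℤ.- q ℤ.* d ≡ r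
  cancel = solve-∀
  remainder : p ℤ.+ ℤ.- (p /ℕ d) ℤ.* + d ≡ + (p %ℕ d)
  remainder = trans (cong (λ n → n ℤ.+ ℤ.- (p /ℕ d) ℤ.* + d) (a≡a%ℕn+[a/ℕn]*n p d))
                    (cancel (+ (p %ℕ d)) (p /ℕ d) (+ d))

-- The value of B₁ (r / d) for 0 ≤ r < d.
sawtooth : ℕ → (d : ℕ) .{{_ : NonZero d}} → ℚ
sawtooth zero      d = ℚ.0ℚ
sawtooth r@(suc _) d = (+ r) / d ℚ.- ½

sawtooth-≢0 : ∀ r d .{{_ : NonZero d}} → r ≢ 0 → sawtooth r d ≡ (+ r) / d ℚ.- ½
sawtooth-≢0 zero    d r≢0 = ⊥-elim (r≢0 refl)
sawtooth-≢0 (suc r) d r≢0 = refl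

sawtooth-* : ∀ r v g .{{_ : NonZero v}} .{{_ : NonZero g}} →
  sawtooth (r ℕ.* g) (v ℕ.* g) {{m*n≢0 v g}} ≡ sawtooth r v
sawtooth-* zero    v g         = refl
sawtooth-* (suc r) v g@(suc _) = cong (ℚ._- ½) (*≡*⇒/≡ (+ (suc r ℕ.* g)) (v ℕ.* g) (+ suc r) v {{m*n≢0 v g}} (begin
  + (suc r ℕ.* g) ℤ.* + v          ≡⟨ cong (ℤ._* + v) (ℤP.pos-* (suc r) g) ⟩
  + suc r ℤ.* + g ℤ.* + v          ≡⟨ rearrange (+ suc r) (+ g) (+ v) ⟩
  + suc r ℤ.* (+ v ℤ.* + g)        ≡⟨ cong (+ suc r ℤ.*_) (ℤP.pos-* v g) ⟨
  + suc r ℤ.* + (v ℕ.* g)          ∎))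
  where
  open ≡-Reasoning
  rearrange : ∀ r g v → r ℤ.* g ℤ.* v ≡ r ℤ.* (v ℤ.* g)
  rearrange = solve-∀

B₁≡sawtooth : ∀ x → B₁ x ≡ sawtooth (↥ x %ℕ ↧ₙ x) (↧ₙ x)
B₁≡sawtooth (mkℚ u zero _) rewrite ℕP.n<1⇒n≡0 (n%ℕd<d u 1) = refl
B₁≡sawtooth x@(mkℚ u (suc v-2) coprime) = begin
  x ℚ.- floor x / 1 ℚ.- ½                  ≡⟨ cong (λ q → x ℚ.- q / 1 ℚ.- ½) (div-pos-is-/ℕ u v) ⟩
  x ℚ.- (u /ℕ v) / 1 ℚ.- ½                 ≡⟨ cong (λ y → y ℚ.- (u /ℕ v) / 1 ℚ.- ½) (ℚP.↥p/↧p≡p x) ⟨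
  u / v ℚ.- (u /ℕ v) / 1 ℚ.- ½             ≡⟨ cong (ℚ._- ½) (p/d-[p/ℕd]≡[p%ℕd]/d u v) ⟩
  (+ (u %ℕ v)) / v ℚ.- ½                   ≡⟨ sawtooth-≢0 (u %ℕ v) v remainder≢0 ⟨
  sawtooth (u %ℕ v) v                      ∎
  where
  open ≡-Reasoning
  v : ℕ
  v = suc (suc v-2)
  remainder≢0 : u %ℕ v ≢ 0
  remainder≢0 r≡0 with Coprimality.recompute coprime (%ℕ≡0⇒∣ u v r≡0 , ∣-refl)
  ... | ()

B₁-/ : ∀ p d .{{_ : NonZero d}} → B₁ (p / d) ≡ sawtooth (p %ℕ d) d
B₁-/ p d = begin
  B₁ x                                                    ≡⟨ B₁≡sawtooth x ⟩
  sawtooth (↥ x %ℕ ↧ₙ x) (↧ₙ x)                           ≡⟨ sawtooth-* (↥ x %ℕ ↧ₙ x) (↧ₙ x) g ⟨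
  sawtooth ((↥ x %ℕ ↧ₙ x) ℕ.* g) (↧ₙ x ℕ.* g)             ≡⟨ cong (λ r → sawtooth r (↧ₙ x ℕ.* g))
                                                               ([ug]%ℕ[vg]≡[u%ℕv]*g (↥ x) (↧ₙ x) g) ⟨
  sawtooth ((↥ x ℤ.* + g) %ℕ (↧ₙ x ℕ.* g)) (↧ₙ x ℕ.* g)   ≡⟨ unscale (ℚP.↥-/ p d)
                                                               (ℤP.+-injective (trans (ℤP.pos-* (↧ₙ x) g) (ℚP.↧-/ p d))) ⟩
  sawtooth (p %ℕ d) d                                     ∎
  where
  open ≡-Reasoning
  x : ℚ
  x = p / d
  g : ℕ
  g = gcd ℤ.∣ p ∣ d
  instance
    g≢0 : NonZero g
    g≢0 = ℕ.≢-nonZero (gcd[m,n]≢0 ℤ.∣ p ∣ d (inj₂ (ℕ.≢-nonZero⁻¹ d)))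
    ↧x*g≢0 : NonZero (↧ₙ x ℕ.* g)
    ↧x*g≢0 = m*n≢0 (↧ₙ x) g
  unscale : ∀ {p′ d′} .{{_ : NonZero d′}} → p′ ≡ p → d′ ≡ d → sawtooth (p′ %ℕ d′) d′ ≡ sawtooth (p %ℕ d) d
  unscale refl refl = refl

r<d⇒B₁[r/d]≡sawtooth : ∀ r d .{{_ : NonZero d}} → r ℕ.< d → B₁ ((+ r) / d) ≡ sawtooth r d
r<d⇒B₁[r/d]≡sawtooth r d r<d = trans (B₁-/ (+ r) d) (cong (λ r → sawtooth r d) (m<n⇒m%n≡m r<d))

B₁-+-ℤ : ∀ x z → B₁ (x ℚ.+ z / 1) ≡ B₁ x
B₁-+-ℤ x z = begin
  B₁ (x ℚ.+ z / 1)                      ≡⟨ cong (λ y → B₁ (y ℚ.+ z / 1)) (ℚP.↥p/↧p≡p x) ⟨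
  B₁ (↥ x / ↧ₙ x ℚ.+ z / 1)             ≡⟨ cong B₁ (p/d+z≡[p+zd]/d (↥ x) (↧ₙ x) z) ⟩
  B₁ ((↥ x ℤ.+ z ℤ.* ↧ x) / ↧ₙ x)       ≡⟨ B₁-/ (↥ x ℤ.+ z ℤ.* ↧ x) (↧ₙ x) ⟩
  sawtooth ((↥ x ℤ.+ z ℤ.* ↧ x) %ℕ ↧ₙ x) (↧ₙ x) ≡⟨ cong (λ r → sawtooth r (↧ₙ x))
                                                     ([p+zd]%ℕd≡p%ℕd (↥ x) z (↧ₙ x)) ⟩
  sawtooth (↥ x %ℕ ↧ₙ x) (↧ₙ x)         ≡⟨ B₁-/ (↥ x) (↧ₙ x) ⟨
  B₁ (↥ x / ↧ₙ x)                       ≡⟨ cong B₁ (ℚP.↥p/↧p≡p x) ⟩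
  B₁ x                                  ∎
  where open ≡-Reasoning

B₁-shift : ∀ x α c a k j .{{_ : NonZero α}} .{{_ : NonZero c}} →
  B₁ (x ℚ.+ ((+ α ℤ.* a) ℤ.* + (k ℕ.* c ℕ.+ j) / (α ℕ.* c)) {{m*n≢0 α c}}) ≡ B₁ (x ℚ.+ (a ℤ.* + j) / c)
B₁-shift x α c a k j = begin
  B₁ (x ℚ.+ (+ α ℤ.* a) ℤ.* + (k ℕ.* c ℕ.+ j) / (α ℕ.* c))  ≡⟨ cong (λ y → B₁ (x ℚ.+ y)) split ⟩
  B₁ (x ℚ.+ ((a ℤ.* + j) / c ℚ.+ (a ℤ.* + k) / 1))          ≡⟨ cong B₁ (ℚP.+-assoc x ((a ℤ.* + j) / c) ((a ℤ.* + k) / 1)) ⟨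
  B₁ (x ℚ.+ (a ℤ.* + j) / c ℚ.+ (a ℤ.* + k) / 1)            ≡⟨ B₁-+-ℤ (x ℚ.+ (a ℤ.* + j) / c) (a ℤ.* + k) ⟩
  B₁ (x ℚ.+ (a ℤ.* + j) / c)                                ∎
  where
  open ≡-Reasoning
  instance
    αc≢0 : NonZero (α ℕ.* c)
    αc≢0 = m*n≢0 α c
  regroup : ∀ α a k c j → (α ℤ.* a) ℤ.* (k ℤ.* c ℤ.+ j) ℤ.* c ≡ (a ℤ.* j ℤ.+ (a ℤ.* k) ℤ.* c) ℤ.* (α ℤ.* c)
  regroup = solve-∀
  cross : (+ α ℤ.* a) ℤ.* + (k ℕ.* c ℕ.+ j) ℤ.* + c ≡ (a ℤ.* + j ℤ.+ (a ℤ.* + k) ℤ.* + c) ℤ.* + (α ℕ.* c)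
  cross = begin
    (+ α ℤ.* a) ℤ.* + (k ℕ.* c ℕ.+ j) ℤ.* + c                 ≡⟨ cong (λ n → (+ α ℤ.* a) ℤ.* n ℤ.* + c)
                                                                   (trans (ℤP.pos-+ (k ℕ.* c) j) (cong (ℤ._+ + j) (ℤP.pos-* k c))) ⟩
    (+ α ℤ.* a) ℤ.* (+ k ℤ.* + c ℤ.+ + j) ℤ.* + c             ≡⟨ regroup (+ α) a (+ k) (+ c) (+ j) ⟩
    (a ℤ.* + j ℤ.+ (a ℤ.* + k) ℤ.* + c) ℤ.* (+ α ℤ.* + c)     ≡⟨ cong ((a ℤ.* + j ℤ.+ (a ℤ.* + k) ℤ.* + c) ℤ.*_)
                                                                   (ℤP.pos-* α c) ⟨
    (a ℤ.* + j ℤ.+ (a ℤ.* + k) ℤ.* + c) ℤ.* + (α ℕ.* c)       ∎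
  split : (+ α ℤ.* a) ℤ.* + (k ℕ.* c ℕ.+ j) / (α ℕ.* c) ≡ (a ℤ.* + j) / c ℚ.+ (a ℤ.* + k) / 1
  split = trans (*≡*⇒/≡ ((+ α ℤ.* a) ℤ.* + (k ℕ.* c ℕ.+ j)) (α ℕ.* c) (a ℤ.* + j ℤ.+ (a ℤ.* + k) ℤ.* + c) c cross)
                (sym (p/d+z≡[p+zd]/d (a ℤ.* + j) c (a ℤ.* + k)))

-- ℚ with the identity as conjugation, so that Σ< also sums rationals.
ℚ-conjRing : ConjRing 0ℓ 0ℓ
ℚ-conjRing = record
  { R          = ℚP.+-*-commutativeRing
  ; ι          = id
  ; ι-hom      = Identity.isRingHomomorphism _ refl
  ; conj       = id
  ; conj-hom   = Identity.isRingHomomorphism _ refl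
  ; conj-invol = λ _ → refl
  ; conj-ι     = λ _ → refl
  }

Σℚ : ℕ → (ℕ → ℚ) → ℚ
Σℚ = Σ< ℚ-conjRing

module _ {c ℓ : Level} (K : ConjRing c ℓ) where
  open ConjRing K renaming (refl to ≈-refl; sym to ≈-sym; trans to ≈-trans)
  open CommutativeSemigroupProperties +-commutativeSemigroup using (interchange)
  open RingMorphisms.IsRingHomomorphism ι-hom using (0#-homo; +-homo)
  open import Relation.Binary.Reasoning.Setoid setoid

  private
    Σ : ℕ → (ℕ → Carrier) → Carrier
    Σ = Σ< K

  Σ<-cong : ∀ n {f g} → (∀ i → i ℕ.< n → f i ≈ g i) → Σ n f ≈ Σ n g
  Σ<-cong zero    f≈g = ≈-refl
  Σ<-cong (suc n) f≈g = +-cong (Σ<-cong n (λ i i<n → f≈g i (ℕP.m<n⇒m<1+n i<n))) (f≈g n ℕP.≤-refl)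

  Σ<-0 : ∀ n → Σ n (λ _ → 0#) ≈ 0#
  Σ<-0 zero    = ≈-refl
  Σ<-0 (suc n) = ≈-trans (+-identityʳ (Σ n (λ _ → 0#))) (Σ<-0 n)

  Σ<-+ : ∀ n f g → Σ n (λ i → f i + g i) ≈ Σ n f + Σ n g
  Σ<-+ zero    f g = ≈-sym (+-identityʳ 0#)
  Σ<-+ (suc n) f g = ≈-trans (+-congʳ (Σ<-+ n f g)) (interchange (Σ n f) (Σ n g) (f n) (g n))

  Σ<-swap : ∀ m n (f : ℕ → ℕ → Carrier) → Σ m (λ i → Σ n (f i)) ≈ Σ n (λ j → Σ m (λ i → f i j))
  Σ<-swap zero    n f = ≈-sym (Σ<-0 n)
  Σ<-swap (suc m) n f = ≈-trans (+-congʳ (Σ<-swap m n f)) (≈-sym (Σ<-+ n (λ j → Σ m (λ i → f i j)) (f m)))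

  Σ<-+-split : ∀ m n f → Σ (m ℕ.+ n) f ≈ Σ m f + Σ n (λ i → f (m ℕ.+ i))
  Σ<-+-split m zero    f = ≈-trans (reflexive (cong (λ k → Σ k f) (ℕP.+-identityʳ m))) (≈-sym (+-identityʳ (Σ m f)))
  Σ<-+-split m (suc n) f = begin
    Σ (m ℕ.+ suc n) f                                ≡⟨ cong (λ k → Σ k f) (ℕP.+-suc m n) ⟩
    Σ (m ℕ.+ n) f + f (m ℕ.+ n)                      ≈⟨ +-congʳ (Σ<-+-split m n f) ⟩
    Σ m f + Σ n (λ i → f (m ℕ.+ i)) + f (m ℕ.+ n)    ≈⟨ +-assoc (Σ m f) (Σ n (λ i → f (m ℕ.+ i))) (f (m ℕ.+ n)) ⟩
    Σ m f + Σ (suc n) (λ i → f (m ℕ.+ i))            ∎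

  Σ<-*-blocks : ∀ α n f → Σ (α ℕ.* n) f ≈ Σ α (λ k → Σ n (λ j → f (k ℕ.* n ℕ.+ j)))
  Σ<-*-blocks zero    n f = ≈-refl
  Σ<-*-blocks (suc α) n f = begin
    Σ (n ℕ.+ α ℕ.* n) f                              ≡⟨ cong (λ k → Σ k f) (ℕP.+-comm n (α ℕ.* n)) ⟩
    Σ (α ℕ.* n ℕ.+ n) f                              ≈⟨ Σ<-+-split (α ℕ.* n) n f ⟩
    Σ (α ℕ.* n) f + Σ n (λ j → f (α ℕ.* n ℕ.+ j))    ≈⟨ +-congʳ (Σ<-*-blocks α n f) ⟩
    Σ (suc α) (λ k → Σ n (λ j → f (k ℕ.* n ℕ.+ j)))  ∎

  Σ<-*ˡ : ∀ n x f → Σ n (λ i → x * f i) ≈ x * Σ n f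
  Σ<-*ˡ zero    x f = ≈-sym (zeroʳ x)
  Σ<-*ˡ (suc n) x f = ≈-trans (+-congʳ (Σ<-*ˡ n x f)) (≈-sym (distribˡ x (Σ n f) (f n)))

  Σ<-*ʳ : ∀ n y f → Σ n (λ i → f i * y) ≈ Σ n f * y
  Σ<-*ʳ zero    y f = ≈-sym (zeroˡ y)
  Σ<-*ʳ (suc n) y f = ≈-trans (+-congʳ (Σ<-*ʳ n y f)) (≈-sym (distribʳ y (Σ n f) (f n)))

  ι-Σℚ : ∀ n f → ι (Σℚ n f) ≈ Σ n (ι ∘ f)
  ι-Σℚ zero    f = 0#-homo
  ι-Σℚ (suc n) f = ≈-trans (+-homo (Σℚ n f) (f n)) (+-congʳ (ι-Σℚ n f))

-- The distribution relation

k*c+j<α*c : ∀ {α c k j} → k ℕ.< α → j ℕ.< c → k ℕ.* c ℕ.+ j ℕ.< α ℕ.* c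
k*c+j<α*c {α} {c} {k} {j} k<α j<c = begin-strict
  k ℕ.* c ℕ.+ j     <⟨ ℕP.+-monoʳ-< (k ℕ.* c) j<c ⟩
  k ℕ.* c ℕ.+ c     ≡⟨ ℕP.+-comm (k ℕ.* c) c ⟩
  suc k ℕ.* c       ≤⟨ ℕP.*-monoˡ-≤ c k<α ⟩
  α ℕ.* c           ∎
  where open ℕP.≤-Reasoning

module _ (α c : ℕ) .{{_ : NonZero α}} .{{_ : NonZero c}} (j : ℕ) where
  private
    instance
      αc≢0 : NonZero (α ℕ.* c)
      αc≢0 = m*n≢0 α c
      E≢0 : NonZero (α ℕ.* c ℕ.* 2)
      E≢0 = m*n≢0 (α ℕ.* c) 2
      c*2≢0 : NonZero (c ℕ.* 2)
      c*2≢0 = m*n≢0 c 2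

    E : ℕ
    E = α ℕ.* c ℕ.* 2

    +E≡ : + E ≡ + α ℤ.* + c ℤ.* + 2
    +E≡ = trans (ℤP.pos-* (α ℕ.* c) 2) (cong (ℤ._* + 2) (ℤP.pos-* α c))

    B : ℕ → ℚ
    B k = B₁ ((+ (k ℕ.* c ℕ.+ j)) / (α ℕ.* c))

    -- (k c + j) / (α c) − ½ = numerator k / E
    numerator : ℕ → ℤ
    numerator k = + (k ℕ.* c ℕ.+ j) ℤ.* + 2 ℤ.- + (α ℕ.* c)

    numerator≡ : ∀ k → numerator k ≡ (+ k ℤ.* + c ℤ.+ + j) ℤ.* + 2 ℤ.- + α ℤ.* + c
    numerator≡ k = cong₂ (λ n m → n ℤ.* + 2 ℤ.- m)
      (trans (ℤP.pos-+ (k ℕ.* c) j) (cong (ℤ._+ + j) (ℤP.pos-* k c))) (ℤP.pos-* α c)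

    -- closed form of Σ_{k<m} numerator k
    Σnumerator : ℤ → ℤ
    Σnumerator m = m ℤ.* m ℤ.* + c ℤ.+ m ℤ.* (+ 2 ℤ.* + j ℤ.- + c) ℤ.- m ℤ.* (+ α ℤ.* + c)

    Σ-numerator/E : ∀ m → Σℚ m (λ k → numerator k / E) ≡ Σnumerator (+ m) / E
    Σ-numerator/E zero    = trans (sym (ℚP.0/n≡0 E)) (cong (_/ E) (vanish (+ c) (+ j) (+ α)))
      where
      vanish : ∀ c j α → + 0 ≡ + 0 ℤ.* + 0 ℤ.* c ℤ.+ + 0 ℤ.* (+ 2 ℤ.* j ℤ.- c) ℤ.- + 0 ℤ.* (α ℤ.* c)
      vanish = solve-∀
    Σ-numerator/E (suc m) = begin
      Σℚ m (λ k → numerator k / E) ℚ.+ numerator m / E   ≡⟨ cong (ℚ._+ numerator m / E) (Σ-numerator/E m) ⟩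
      Σnumerator (+ m) / E ℚ.+ numerator m / E           ≡⟨ p/d+r/d≡[p+r]/d (Σnumerator (+ m)) (numerator m) E ⟩
      (Σnumerator (+ m) ℤ.+ numerator m) / E             ≡⟨ cong (λ n → (Σnumerator (+ m) ℤ.+ n) / E) (numerator≡ m) ⟩
      (Σnumerator (+ m) ℤ.+ ((+ m ℤ.* + c ℤ.+ + j) ℤ.* + 2 ℤ.- + α ℤ.* + c)) / E
                                                         ≡⟨ cong (_/ E) (step (+ m) (+ c) (+ j) (+ α)) ⟩
      Σnumerator (ℤ.1ℤ ℤ.+ + m) / E                      ≡⟨ cong (λ n → Σnumerator n / E) (ℤP.pos-+ 1 m) ⟨
      Σnumerator (+ suc m) / E                           ∎
      where
      open ≡-Reasoning
      step : ∀ m c j α →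
        m ℤ.* m ℤ.* c ℤ.+ m ℤ.* (+ 2 ℤ.* j ℤ.- c) ℤ.- m ℤ.* (α ℤ.* c)
          ℤ.+ ((m ℤ.* c ℤ.+ j) ℤ.* + 2 ℤ.- α ℤ.* c)
        ≡ (ℤ.1ℤ ℤ.+ m) ℤ.* (ℤ.1ℤ ℤ.+ m) ℤ.* c ℤ.+ (ℤ.1ℤ ℤ.+ m) ℤ.* (+ 2 ℤ.* j ℤ.- c)
          ℤ.- (ℤ.1ℤ ℤ.+ m) ℤ.* (α ℤ.* c)
      step = solve-∀

    B≡numerator/E : ∀ k → k ℕ.< α → j ℕ.< c → k ℕ.* c ℕ.+ j ≢ 0 → B k ≡ numerator k / E
    B≡numerator/E k k<α j<c kc+j≢0 = begin
      B k                                            ≡⟨ r<d⇒B₁[r/d]≡sawtooth (k ℕ.* c ℕ.+ j) (α ℕ.* c) (k*c+j<α*c k<α j<c) ⟩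
      sawtooth (k ℕ.* c ℕ.+ j) (α ℕ.* c)             ≡⟨ sawtooth-≢0 (k ℕ.* c ℕ.+ j) (α ℕ.* c) kc+j≢0 ⟩
      (+ (k ℕ.* c ℕ.+ j)) / (α ℕ.* c) ℚ.- ½          ≡⟨ p/d-½≡[2p-d]/[2d] (+ (k ℕ.* c ℕ.+ j)) (α ℕ.* c) ⟩
      numerator k / E                                ∎
      where open ≡-Reasoning

    -[αc]/E+½≡0 : ∀ p → p ≡ ℤ.- (+ α ℤ.* + c) → p / E ℚ.+ ½ ≡ ℚ.0ℚ
    -[αc]/E+½≡0 p refl = begin
      p / E ℚ.+ ½                                 ≡⟨ p/d+r/e≡[pe+rd]/[de] p E (+ 1) 2 ⟩
      (p ℤ.* + 2 ℤ.+ + 1 ℤ.* + E) / (E ℕ.* 2)     ≡⟨ ℚP./-cong (trans (cong (λ e → p ℤ.* + 2 ℤ.+ + 1 ℤ.* e) +E≡)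
                                                                      (cancel (+ α) (+ c))) refl ⟩
      + 0 / (E ℕ.* 2)                             ≡⟨ ℚP.0/n≡0 (E ℕ.* 2) ⟩
      ℚ.0ℚ                                        ∎
      where
      open ≡-Reasoning
      instance
        E*2≢0 : NonZero (E ℕ.* 2)
        E*2≢0 = m*n≢0 E 2
      cancel : ∀ α c → ℤ.- (α ℤ.* c) ℤ.* + 2 ℤ.+ + 1 ℤ.* (α ℤ.* c ℤ.* + 2) ≡ + 0
      cancel = solve-∀

    ΣB-≢0 : j ℕ.< c → j ≢ 0 → Σℚ α B ≡ B₁ ((+ j) / c)
    ΣB-≢0 j<c j≢0 = begin
      Σℚ α B                                 ≡⟨ Σ<-cong ℚ-conjRing α (λ k k<α →
                                                  B≡numerator/E k k<α j<c (j≢0 ∘ ℕP.m+n≡0⇒n≡0 (k ℕ.* c))) ⟩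
      Σℚ α (λ k → numerator k / E)           ≡⟨ Σ-numerator/E α ⟩
      Σnumerator (+ α) / E                   ≡⟨ *≡*⇒/≡ (Σnumerator (+ α)) E (+ j ℤ.* + 2 ℤ.- + c) (c ℕ.* 2) cross ⟩
      (+ j ℤ.* + 2 ℤ.- + c) / (c ℕ.* 2)      ≡⟨ p/d-½≡[2p-d]/[2d] (+ j) c ⟨
      (+ j) / c ℚ.- ½                        ≡⟨ sawtooth-≢0 j c j≢0 ⟨
      sawtooth j c                           ≡⟨ r<d⇒B₁[r/d]≡sawtooth j c j<c ⟨
      B₁ ((+ j) / c)                         ∎
      where
      open ≡-Reasoning
      collapse : ∀ α c j → (α ℤ.* α ℤ.* c ℤ.+ α ℤ.* (+ 2 ℤ.* j ℤ.- c) ℤ.- α ℤ.* (α ℤ.* c)) ℤ.* (c ℤ.* + 2)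
                           ≡ (j ℤ.* + 2 ℤ.- c) ℤ.* (α ℤ.* c ℤ.* + 2)
      collapse = solve-∀
      cross : Σnumerator (+ α) ℤ.* + (c ℕ.* 2) ≡ (+ j ℤ.* + 2 ℤ.- + c) ℤ.* + E
      cross = begin
        Σnumerator (+ α) ℤ.* + (c ℕ.* 2)                  ≡⟨ cong (Σnumerator (+ α) ℤ.*_) (ℤP.pos-* c 2) ⟩
        Σnumerator (+ α) ℤ.* (+ c ℤ.* + 2)                ≡⟨ collapse (+ α) (+ c) (+ j) ⟩
        (+ j ℤ.* + 2 ℤ.- + c) ℤ.* (+ α ℤ.* + c ℤ.* + 2)   ≡⟨ cong ((+ j ℤ.* + 2 ℤ.- + c) ℤ.*_) +E≡ ⟨
        (+ j ℤ.* + 2 ℤ.- + c) ℤ.* + E                     ∎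

    -- Only the term k = 0 differs from numerator k / E, namely by ½.
    ΣB≡Σnumerator/E+½ : j ≡ 0 → ∀ m → 0 ℕ.< m → m ℕ.≤ α → Σℚ m B ≡ Σℚ m (λ k → numerator k / E) ℚ.+ ½
    ΣB≡Σnumerator/E+½ refl (suc zero) _ 1≤α = begin
      ℚ.0ℚ ℚ.+ B 0                       ≡⟨ cong (ℚ.0ℚ ℚ.+_)
                                              (r<d⇒B₁[r/d]≡sawtooth 0 (α ℕ.* c) (k*c+j<α*c 1≤α (ℕ.>-nonZero⁻¹ c))) ⟩
      ℚ.0ℚ ℚ.+ ℚ.0ℚ                      ≡⟨ -[αc]/E+½≡0 (numerator 0) (trans (numerator≡ 0) (collapse (+ α) (+ c))) ⟨
      numerator 0 / E ℚ.+ ½              ≡⟨ cong (ℚ._+ ½) (ℚP.+-identityˡ (numerator 0 / E)) ⟨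
      ℚ.0ℚ ℚ.+ numerator 0 / E ℚ.+ ½     ∎
      where
      open ≡-Reasoning
      collapse : ∀ α c → (+ 0 ℤ.* c ℤ.+ + 0) ℤ.* + 2 ℤ.- α ℤ.* c ≡ ℤ.- (α ℤ.* c)
      collapse = solve-∀
    ΣB≡Σnumerator/E+½ refl (suc (suc m)) _ m+2≤α = begin
      Σℚ (suc m) B ℚ.+ B (suc m)                   ≡⟨ cong₂ ℚ._+_ (ΣB≡Σnumerator/E+½ refl (suc m) ℕ.z<s (ℕP.<⇒≤ m+2≤α))
                                                        (B≡numerator/E (suc m) m+2≤α (ℕ.>-nonZero⁻¹ c) [m+1]c≢0) ⟩
      Σ′ ℚ.+ ½ ℚ.+ numerator (suc m) / E          ≡⟨ xy∙z≈xz∙y Σ′ ½ (numerator (suc m) / E) ⟩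
      Σ′ ℚ.+ numerator (suc m) / E ℚ.+ ½          ∎
      where
      open ≡-Reasoning
      [m+1]c≢0 : suc m ℕ.* c ℕ.+ 0 ≢ 0
      [m+1]c≢0 = ℕ.≢-nonZero⁻¹ c ∘ ℕP.m+n≡0⇒m≡0 c ∘ ℕP.m+n≡0⇒m≡0 (c ℕ.+ m ℕ.* c)
      Σ′ : ℚ
      Σ′ = Σℚ (suc m) (λ k → numerator k / E)

    ΣB-≡0 : j ≡ 0 → Σℚ α B ≡ B₁ ((+ j) / c)
    ΣB-≡0 refl = begin
      Σℚ α B                                     ≡⟨ ΣB≡Σnumerator/E+½ refl α (ℕ.>-nonZero⁻¹ α) ℕP.≤-refl ⟩
      Σℚ α (λ k → numerator k / E) ℚ.+ ½         ≡⟨ cong (ℚ._+ ½) (Σ-numerator/E α) ⟩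
      Σnumerator (+ α) / E ℚ.+ ½                 ≡⟨ -[αc]/E+½≡0 (Σnumerator (+ α)) (collapse (+ α) (+ c)) ⟩
      ℚ.0ℚ                                       ≡⟨ r<d⇒B₁[r/d]≡sawtooth 0 c (ℕ.>-nonZero⁻¹ c) ⟨
      B₁ ((+ 0) / c)                             ∎
      where
      open ≡-Reasoning
      collapse : ∀ α c → α ℤ.* α ℤ.* c ℤ.+ α ℤ.* (+ 2 ℤ.* + 0 ℤ.- c) ℤ.- α ℤ.* (α ℤ.* c) ≡ ℤ.- (α ℤ.* c)
      collapse = solve-∀

  B₁-distribution : j ℕ.< c → Σℚ α (λ k → B₁ ((+ (k ℕ.* c ℕ.+ j)) / (α ℕ.* c))) ≡ B₁ ((+ j) / c)
  B₁-distribution j<c with j ℕ.≟ 0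
  ... | yes j≡0 = ΣB-≡0 j≡0
  ... | no  j≢0 = ΣB-≢0 j<c j≢0

module _ {c ℓ : Level} (K : ConjRing c ℓ) where
  open ConjRing K renaming (refl to ≈-refl; sym to ≈-sym; trans to ≈-trans)
  open RingMorphisms.IsRingHomomorphism conj-hom using (⟦⟧-cong)
  open import Relation.Binary.Reasoning.Setoid setoid

  module _ {q : ℕ} (ψ : DirichletChar K q) where
    open DirichletChar ψ using (χ; χ-periodic)

    χ-+-multiple : ∀ m j → χ (+ (m ℕ.* q ℕ.+ j)) ≈ χ (+ j)
    χ-+-multiple zero    j = ≈-refl
    χ-+-multiple (suc m) j = begin
      χ (+ (q ℕ.+ m ℕ.* q ℕ.+ j))     ≡⟨ cong χ (trans (cong +_ (rotate q (m ℕ.* q) j)) (ℤP.pos-+ (m ℕ.* q ℕ.+ j) q)) ⟩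
      χ (+ (m ℕ.* q ℕ.+ j) ℤ.+ + q)   ≈⟨ χ-periodic (+ (m ℕ.* q ℕ.+ j)) ⟩
      χ (+ (m ℕ.* q ℕ.+ j))           ≈⟨ χ-+-multiple m j ⟩
      χ (+ j)                         ∎
      where
      rotate : ∀ q n j → q ℕ.+ n ℕ.+ j ≡ n ℕ.+ j ℕ.+ q
      rotate q n j = trans (ℕP.+-assoc q n j) (ℕP.+-comm q (n ℕ.+ j))

    χ-+-multiple-∣ : ∀ {c} → q ∣ c → ∀ k j → χ (+ (k ℕ.* c ℕ.+ j)) ≈ χ (+ j)
    χ-+-multiple-∣ (divides t refl) k j = begin
      χ (+ (k ℕ.* (t ℕ.* q) ℕ.+ j))   ≡⟨ cong (λ n → χ (+ (n ℕ.+ j))) (ℕP.*-assoc k t q) ⟨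
      χ (+ (k ℕ.* t ℕ.* q ℕ.+ j))     ≈⟨ χ-+-multiple (k ℕ.* t) j ⟩
      χ (+ j)                         ∎

  module _ {q₁ q₂ : ℕ} .{{_ : NonZero q₁}} (χ₁ : DirichletChar K q₁) (χ₂ : DirichletChar K q₂) where
    private
      χ̄₁ χ̄₂ : ℤ → Carrier
      χ̄₁ n = conj (DirichletChar.χ χ₁ n)
      χ̄₂ n = conj (DirichletChar.χ χ₂ n)

    S-term : ℤ → (c : ℕ) .{{_ : NonZero c}} → ℕ → ℕ → Carrier
    S-term a c j n = χ̄₂ (+ j) * χ̄₁ (+ n) * ι (B₁ ((+ j) / c)) * ι (B₁ ((+ n) / q₁ ℚ.+ (a ℤ.* + j) / c))

    Σ-lifts-S-term : ∀ a α c .{{_ : NonZero α}} .{{_ : NonZero c}} → q₂ ∣ c → ∀ j → j ℕ.< c → ∀ n →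
      Σ< K α (λ k → S-term (+ α ℤ.* a) (α ℕ.* c) {{m*n≢0 α c}} (k ℕ.* c ℕ.+ j) n) ≈ S-term a c j n
    Σ-lifts-S-term a α c q₂∣c j j<c n = begin
      Σ< K α (λ k → S-term (+ α ℤ.* a) (α ℕ.* c) (k ℕ.* c ℕ.+ j) n)  ≈⟨ Σ<-cong K α (λ k _ → lift k) ⟩
      Σ< K α (λ k → X * ι (B k) * Y)                                 ≈⟨ Σ<-*ʳ K α Y (λ k → X * ι (B k)) ⟩
      Σ< K α (λ k → X * ι (B k)) * Y                                 ≈⟨ *-congʳ (Σ<-*ˡ K α X (ι ∘ B)) ⟩
      X * Σ< K α (ι ∘ B) * Y                                         ≈⟨ *-congʳ (*-congˡ (ι-Σℚ K α B)) ⟨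
      X * ι (Σℚ α B) * Y                                             ≡⟨ cong (λ b → X * ι b * Y) (B₁-distribution α c j j<c) ⟩
      S-term a c j n                                                 ∎
      where
      instance
        αc≢0 : NonZero (α ℕ.* c)
        αc≢0 = m*n≢0 α c
      X Y : Carrier
      X = χ̄₂ (+ j) * χ̄₁ (+ n)
      Y = ι (B₁ ((+ n) / q₁ ℚ.+ (a ℤ.* + j) / c))
      B : ℕ → ℚ
      B k = B₁ ((+ (k ℕ.* c ℕ.+ j)) / (α ℕ.* c))
      lift : ∀ k → S-term (+ α ℤ.* a) (α ℕ.* c) (k ℕ.* c ℕ.+ j) n ≈ X * ι (B k) * Y
      lift k = *-cong (*-congʳ (*-congʳ (⟦⟧-cong (χ-+-multiple-∣ χ₂ q₂∣c k j))))
                      (reflexive (cong ι (B₁-shift ((+ n) / q₁) α c a k j)))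

proposition2p1 : {c ℓ : Level} (K : ConjRing c ℓ) (q₁ q₂ : ℕ) .{{_ : NonZero q₁}} .{{_ : NonZero q₂}}
    (χ₁ : DirichletChar K q₁) (χ₂ : DirichletChar K q₂) (a : ℤ) (c' : ℕ) .{{_ : NonZero c'}}
    → Coprime ℤ.∣ a ∣ c' → (q₁ ℕ.* q₂) ∣ c'
    → (α : ℕ) .{{_ : NonZero α}}
    → ConjRing._≈_ K (S K χ₁ χ₂ a c') (S K χ₁ χ₂ (+ α ℤ.* a) (α ℕ.* c') {{m*n≢0 α c'}})
proposition2p1 K q₁ q₂ χ₁ χ₂ a c' _ q₁q₂∣c' α = ≈-sym (begin
  S K χ₁ χ₂ (+ α ℤ.* a) (α ℕ.* c')                                     ≈⟨ Σ<-*-blocks K α c' _ ⟩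
  Σ< K α (λ k → Σ< K c' (λ j → Σ< K q₁ (T (k ℕ.* c' ℕ.+ j))))          ≈⟨ Σ<-swap K α c' _ ⟩
  Σ< K c' (λ j → Σ< K α (λ k → Σ< K q₁ (T (k ℕ.* c' ℕ.+ j))))          ≈⟨ Σ<-cong K c' (λ j _ → Σ<-swap K α q₁ _) ⟩
  Σ< K c' (λ j → Σ< K q₁ (λ n → Σ< K α (λ k → T (k ℕ.* c' ℕ.+ j) n)))  ≈⟨ Σ<-cong K c' (λ j j<c' →
                                                                           Σ<-cong K q₁ (λ n _ →
                                                                             Σ-lifts-S-term K χ₁ χ₂ a α c' q₂∣c' j j<c' n)) ⟩
  S K χ₁ χ₂ a c'                                                       ∎)
  where
  open ConjRing K using (Carrier; setoid) renaming (sym to ≈-sym)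
  open import Relation.Binary.Reasoning.Setoid setoid
  instance
    αc'≢0 : NonZero (α ℕ.* c')
    αc'≢0 = m*n≢0 α c'
  T : ℕ → ℕ → Carrier
  T = S-term K χ₁ χ₂ (+ α ℤ.* a) (α ℕ.* c')
  q₂∣c' : q₂ ∣ c'
  q₂∣c' = ∣-trans (n∣m*n q₁) q₁q₂∣c'
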